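{- Let $u_1,\dots,u_p,v_1,\dots,v_r\in A^+$ with $p,r\ge1$, and let $\gamma$ be a temporal formula. Then $$F_{\{u_1,\dots,u_p,\neg v_1,\dots,\neg v_r\}}\gamma\ \equiv\ \bigwedge_{1\le i\le p}\ \bigwedge_{1\le j\le r} F_{\{u_i,\neg v_j\}}\gamma,$$ i.e. both formulas hold at exactly the same marked words. Moreover, the dag-size of the right-hand formula is bounded by a polynomial in the size of the left-hand formula.
   Context: Words over a finite alphabet $A$ have positions $1,\dots,|w|$. For $u\in A^+$, an occurrence of $u$ strictly between positions $i<j$ of $w$ is a position $k$ with $i<k$, $k+|u|-1<j$ and $w(k)\cdots w(k+|u|-1)=u$. For a finite set $R=\{u_1,\dots,u_p,\neg v_1,\dots,\neg v_r\}$ with $u_i,v_j\in A^+$, $(w,i)\models F_R\gamma$ iff there is $j>i$ with $(w,j)\models\gamma$ such that each $u_t$ has an occurrence strictly between $i$ and $j$ and no $v_t$ has an occurrence strictly between $i$ and $j$. The size of $F_{\{u_1,\dots,u_p,\neg v_1,\dots,\neg v_r\}}\gamma$ is $|u_1|+\dots+|u_p|+|v_1|+\dots+|v_r|+\mathrm{size}(\gamma)+1$. The dag-size of a formula is the number of nodes of its parse dag, in which each syntactically distinct subformula occurs only once. -}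

module Defs where

open import Data.Nat using (ℕ; zero; suc; _+_; _*_; _∸_; _^_; _≤_; _<_)
open import Data.Fin using (Fin)
open import Data.Fin.Properties using () renaming (_≟_ to _≟Fin_)
open import Data.List using (List; []; _∷_; _++_; length; drop; map; deduplicate)
open import Data.Nat.ListAction using (sum)
open import Data.List.NonEmpty using (List⁺; _∷_; toList; foldr₁) renaming (length to length⁺; map to map⁺; _++⁺_ to _⁺++⁺_; concatMap to concatMap⁺)
open import Data.List.Properties using () renaming (≡-dec to List-≡-dec)
open import Data.List.Relation.Unary.All using (All)
open import Data.List.Membership.Propositional using (_∈_)
open import Data.Maybe using (Maybe; just; nothing)
open import Data.Product using (Σ; ∃; _×_; _,_)
open import Data.Unit using (⊤)
open import Relation.Nullary using (¬_; Dec; yes; no)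
open import Relation.Binary.PropositionalEquality using (_≡_; refl; cong; cong₂)
open import Relation.Binary.Definitions using (DecidableEquality)

-- Finite alphabet: A = Fin n.  Nonempty words (A⁺) are List⁺ (Fin n).
-- Words w ∈ A* are List (Fin n), positions are 1 … length w.

Word : ℕ → Set
Word n = List (Fin n)

Word⁺ : ℕ → Set
Word⁺ n = List⁺ (Fin n)

data Lit (n : ℕ) : Set where
  pos : Word⁺ n → Lit n
  neg : Word⁺ n → Lit n

data Formula (n : ℕ) : Set where
  tt     : Formula n
  letter : Fin n → Formula n
  not    : Formula n → Formula n
  and    : Formula n → Formula n → Formula n
  F      : List (Lit n) → Formula n → Formula n
  P      : List (Lit n) → Formula n → Formula n

letterAt : ∀ {n} → Word n → ℕ → Maybe (Fin n)
letterAt []       _             = nothing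
letterAt (a ∷ w)  zero          = nothing
letterAt (a ∷ w)  (suc zero)    = just a
letterAt (a ∷ w)  (suc (suc k)) = letterAt w (suc k)

OccursAt : ∀ {n} → Word n → ℕ → Word⁺ n → Set
OccursAt w k u = 1 ≤ k × Σ (Word _) (λ rest → drop (k ∸ 1) w ≡ toList u ++ rest)

OccursBetween : ∀ {n} → Word n → ℕ → ℕ → Word⁺ n → Set
OccursBetween w i j u =
  Σ ℕ (λ k → i < k × (k + length⁺ u ∸ 1) < j × OccursAt w k u)

LitHolds : ∀ {n} → Word n → ℕ → ℕ → Lit n → Set
LitHolds w i j (pos u) = OccursBetween w i j u
LitHolds w i j (neg v) = ¬ OccursBetween w i j v

Sat : ∀ {n} → Word n → ℕ → Formula n → Set
Sat w i tt          = ⊤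
Sat w i (letter a)  = letterAt w i ≡ just a
Sat w i (not φ)     = ¬ Sat w i φ
Sat w i (and φ ψ)   = Sat w i φ × Sat w i ψ
Sat w i (F R γ)     =
  Σ ℕ (λ j → i < j × j ≤ length w × Sat w j γ × All (LitHolds w i j) R)
Sat w i (P R γ)     =
  Σ ℕ (λ j → 1 ≤ j × j < i × Sat w j γ × All (LitHolds w j i) R)

_≡ₛ_ : ∀ {n} → Formula n → Formula n → Set
_≡ₛ_ {n} φ ψ = (w : Word n) (i : ℕ) → 1 ≤ i → i ≤ length w →
  (Sat w i φ → Sat w i ψ) × (Sat w i ψ → Sat w i φ)

litSize : ∀ {n} → Lit n → ℕ
litSize (pos u) = length⁺ u
litSize (neg v) = length⁺ v

size : ∀ {n} → Formula n → ℕ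
size tt          = 1
size (letter a)  = 1
size (not φ)     = size φ + 1
size (and φ ψ)   = size φ + size ψ + 1
size (F R γ)     = sum (map litSize R) + size γ + 1
size (P R γ)     = sum (map litSize R) + size γ + 1

subformulas : ∀ {n} → Formula n → List (Formula n)
subformulas tt          = tt ∷ []
subformulas (letter a)  = letter a ∷ []
subformulas (not φ)     = not φ ∷ subformulas φ
subformulas (and φ ψ)   = and φ ψ ∷ (subformulas φ ++ subformulas ψ)
subformulas (F R γ)     = F R γ ∷ subformulas γ
subformulas (P R γ)     = P R γ ∷ subformulas γ

_≟W⁺_ : ∀ {n} → DecidableEquality (Word⁺ n)
(a ∷ as) ≟W⁺ (b ∷ bs) with a ≟Fin b | List-≡-dec _≟Fin_ as bs
... | yes refl | yes refl = yes refl
... | no a≢b   | _        = no λ { refl → a≢b refl }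
... | yes _    | no as≢bs = no λ { refl → as≢bs refl }

_≟L_ : ∀ {n} → DecidableEquality (Lit n)
pos u ≟L pos u′ with u ≟W⁺ u′
... | yes refl = yes refl
... | no ne    = no λ { refl → ne refl }
neg u ≟L neg u′ with u ≟W⁺ u′
... | yes refl = yes refl
... | no ne    = no λ { refl → ne refl }
pos _ ≟L neg _ = no λ ()
neg _ ≟L pos _ = no λ ()

_≟F_ : ∀ {n} → DecidableEquality (Formula n)
tt ≟F tt = yes refl
letter a ≟F letter b with a ≟Fin b
... | yes refl = yes refl
... | no ne    = no λ { refl → ne refl }
not φ ≟F not ψ with φ ≟F ψ
... | yes refl = yes refl
... | no ne    = no λ { refl → ne refl }
and φ₁ φ₂ ≟F and ψ₁ ψ₂ with φ₁ ≟F ψ₁ | φ₂ ≟F ψ₂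
... | yes refl | yes refl = yes refl
... | no ne    | _        = no λ { refl → ne refl }
... | yes _    | no ne    = no λ { refl → ne refl }
F R φ ≟F F S ψ with List-≡-dec _≟L_ R S | φ ≟F ψ
... | yes refl | yes refl = yes refl
... | no ne    | _        = no λ { refl → ne refl }
... | yes _    | no ne    = no λ { refl → ne refl }
P R φ ≟F P S ψ with List-≡-dec _≟L_ R S | φ ≟F ψ
... | yes refl | yes refl = yes refl
... | no ne    | _        = no λ { refl → ne refl }
... | yes _    | no ne    = no λ { refl → ne refl }
tt ≟F (letter y0) = no (λ ())
tt ≟F (not y0) = no (λ ())
tt ≟F (and y0 y1) = no (λ ())
tt ≟F (F y0 y1) = no (λ ())
tt ≟F (P y0 y1) = no (λ ())
(letter x0) ≟F tt = no (λ ())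
(letter x0) ≟F (not y0) = no (λ ())
(letter x0) ≟F (and y0 y1) = no (λ ())
(letter x0) ≟F (F y0 y1) = no (λ ())
(letter x0) ≟F (P y0 y1) = no (λ ())
(not x0) ≟F tt = no (λ ())
(not x0) ≟F (letter y0) = no (λ ())
(not x0) ≟F (and y0 y1) = no (λ ())
(not x0) ≟F (F y0 y1) = no (λ ())
(not x0) ≟F (P y0 y1) = no (λ ())
(and x0 x1) ≟F tt = no (λ ())
(and x0 x1) ≟F (letter y0) = no (λ ())
(and x0 x1) ≟F (not y0) = no (λ ())
(and x0 x1) ≟F (F y0 y1) = no (λ ())
(and x0 x1) ≟F (P y0 y1) = no (λ ())
(F x0 x1) ≟F tt = no (λ ())
(F x0 x1) ≟F (letter y0) = no (λ ())
(F x0 x1) ≟F (not y0) = no (λ ())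
(F x0 x1) ≟F (and y0 y1) = no (λ ())
(F x0 x1) ≟F (P y0 y1) = no (λ ())
(P x0 x1) ≟F tt = no (λ ())
(P x0 x1) ≟F (letter y0) = no (λ ())
(P x0 x1) ≟F (not y0) = no (λ ())
(P x0 x1) ≟F (and y0 y1) = no (λ ())
(P x0 x1) ≟F (F y0 y1) = no (λ ())

-- dag-size: number of nodes of the parse dag
--         = number of syntactically distinct subformulas
dagSize : ∀ {n} → Formula n → ℕ
dagSize φ = length (deduplicate _≟F_ (subformulas φ))

lhs : ∀ {n} → List⁺ (Word⁺ n) → List⁺ (Word⁺ n) → Formula n → Formula n
lhs us vs γ = F (map pos (toList us) ++ map neg (toList vs)) γ

⋀ : ∀ {n} → List⁺ (Formula n) → Formula n
⋀ = foldr₁ and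

rhs : ∀ {n} → List⁺ (Word⁺ n) → List⁺ (Word⁺ n) → Formula n → Formula n
rhs us vs γ =
  ⋀ (concatMap⁺ (λ u → map⁺ (λ v → F (pos u ∷ neg v ∷ []) γ) vs) us)

-- Positive constraints u of F_R are upward closed in the target position j (an
-- occurrence strictly between i and j is also one strictly between i and any later
-- j'), negative constraints ¬ v are downward closed.  Hence if every pair formula
-- F_{u,¬v} γ holds, then for a fixed u the least of the witnesses for the pairs
-- (u, v₁), …, (u, v_r) avoids every v; and the greatest of these per-u witnesses
-- contains every u while still avoiding every v.  The conjunction has p · r
-- conjuncts, each with at most size γ + 1 tree nodes, so its dag-size is at most cubic in
-- the size of F_R γ.
module Submission where

open import Defs
open import Data.Nat using (ℕ; suc; _+_; _*_; _^_; _≤_; _<_; s≤s; z≤n)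
open import Data.Nat.Properties
open import Data.List using (List; []; _∷_; _++_; length; map; concat; cartesianProductWith)
open import Data.List.Properties using (length-++; length-map; length-deduplicate)
open import Data.Nat.ListAction using (sum)
open import Data.List.NonEmpty as List⁺ using (List⁺; _∷_; toList)
open import Data.List.Relation.Unary.All as All using (All; []; _∷_)
open import Data.List.Relation.Unary.All.Properties using (++⁺; ++⁻; ++⁻ˡ; ++⁻ʳ; map⁺; map⁻)
open import Data.Product using (Σ; ∃-syntax; _×_; _,_)
open import Data.Sum using (_⊎_; inj₁; inj₂)
open import Function.Base using (_∘_)
open import Function.Bundles using (_⇔_; mk⇔; Equivalence)
open import Function.Construct.Composition using (_⇔-∘_)
open import Relation.Nullary using (¬_)
open import Relation.Binary.PropositionalEquality
  using (_≡_; refl; sym; trans; cong; cong₂; subst; module ≡-Reasoning)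

private
  variable
    n : ℕ
    A B C : Set

module _ {I X : Set} {_≼_ : I → I → Set} (≼-total : ∀ j k → j ≼ k ⊎ k ≼ j)
         {W : I → Set} {Q : X → I → Set} (Q-antitone : ∀ {x j k} → j ≼ k → Q x k → Q x j)
         where

  common-witness : ∀ x xs → All (λ y → ∃[ j ] W j × Q y j) (x ∷ xs) →
                   ∃[ j ] W j × All (λ y → Q y j) (x ∷ xs)
  common-witness x []       ((j , Wj , Qj) ∷ []) = j , Wj , Qj ∷ []
  common-witness x (y ∷ ys) ((j , Wj , Qj) ∷ rest)
    with common-witness y ys rest
  ... | k , Wk , Qks with ≼-total j k
  ... | inj₁ j≼k = j , Wj , Qj ∷ All.map (Q-antitone j≼k) Qks
  ... | inj₂ k≼j = k , Wk , Q-antitone k≼j Qj ∷ Qks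

module _ (f : A → B → C) where

  toList-concatMap⁺-map⁺ : (xs : List⁺ A) (ys : List⁺ B) →
    toList (List⁺.concatMap (λ x → List⁺.map (f x) ys) xs)
      ≡ cartesianProductWith f (toList xs) (toList ys)
  toList-concatMap⁺-map⁺ (x ∷ xs) ys = cong (map (f x) (toList ys) ++_) (tail-eq xs)
    where
    tail-eq : ∀ xs → concat (map toList (map (λ x → List⁺.map (f x) ys) xs))
                     ≡ cartesianProductWith f xs (toList ys)
    tail-eq []       = refl
    tail-eq (x ∷ xs) = cong (map (f x) (toList ys) ++_) (tail-eq xs)

  length-cartesianProductWith : ∀ xs ys →
    length (cartesianProductWith f xs ys) ≡ length xs * length ys
  length-cartesianProductWith []       ys = refl
  length-cartesianProductWith (x ∷ xs) ys = begin
    length (map (f x) ys ++ cartesianProductWith f xs ys)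
      ≡⟨ length-++ (map (f x) ys) ⟩
    length (map (f x) ys) + length (cartesianProductWith f xs ys)
      ≡⟨ cong₂ _+_ (length-map (f x) ys) (length-cartesianProductWith xs ys) ⟩
    length ys + length xs * length ys ∎
    where open ≡-Reasoning

  All-cartesianProductWith : {P : C → Set} → ∀ xs ys →
    All P (cartesianProductWith f xs ys) ⇔ All (λ x → All (λ y → P (f x y)) ys) xs
  All-cartesianProductWith xs ys = mk⇔ (split xs) (join xs)
    where
    split : ∀ xs → All _ (cartesianProductWith f xs ys) → All _ xs
    split []       _ = []
    split (x ∷ xs) p = map⁻ (++⁻ˡ (map (f x) ys) p) ∷ split xs (++⁻ʳ (map (f x) ys) p)
    join : ∀ xs → All _ xs → All _ (cartesianProductWith f xs ys)
    join []       []       = []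
    join (x ∷ xs) (p ∷ ps) = ++⁺ (map⁺ p) (join xs ps)

Sat-⋀ : (w : Word n) (i : ℕ) (φs : List⁺ (Formula n)) →
        Sat w i (⋀ φs) ⇔ All (Sat w i) (toList φs)
Sat-⋀ w i (φ ∷ φs) = mk⇔ (split φ φs) (join φ φs)
  where
  split : ∀ φ φs → Sat w i (⋀ (φ ∷ φs)) → All (Sat w i) (φ ∷ φs)
  split φ []       s         = s ∷ []
  split φ (ψ ∷ ψs) (s , ss) = s ∷ split ψ ψs ss
  join : ∀ φ φs → All (Sat w i) (φ ∷ φs) → Sat w i (⋀ (φ ∷ φs))
  join φ []       (s ∷ [])  = s
  join φ (ψ ∷ ψs) (s ∷ ss)  = s , join ψ ψs ss

Sat-rhs : (w : Word n) (i : ℕ) (us vs : List⁺ (Word⁺ n)) (γ : Formula n) →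
  Sat w i (rhs us vs γ) ⇔
  All (λ u → All (λ v → Sat w i (F (pos u ∷ neg v ∷ []) γ)) (toList vs)) (toList us)
Sat-rhs {n} w i us vs γ =
  All-cartesianProductWith pair (toList us) (toList vs) ⇔-∘
  subst (λ φs → Sat w i (rhs us vs γ) ⇔ All (Sat w i) φs)
        (toList-concatMap⁺-map⁺ pair us vs) (Sat-⋀ w i _)
  where
  pair : Word⁺ n → Word⁺ n → Formula n
  pair u v = F (pos u ∷ neg v ∷ []) γ

occursBetween-monoʳ : ∀ {w : Word n} {i j k u} →
  j ≤ k → OccursBetween w i j u → OccursBetween w i k u
occursBetween-monoʳ j≤k (l , i<l , end<j , occ) = l , i<l , <-≤-trans end<j j≤k , occ

¬occursBetween-antitoneʳ : ∀ {w : Word n} {i j k v} →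
  j ≤ k → ¬ OccursBetween w i k v → ¬ OccursBetween w i j v
¬occursBetween-antitoneʳ j≤k ¬occ occ = ¬occ (occursBetween-monoʳ j≤k occ)

module _ (w : Word n) (i : ℕ) (γ : Formula n) where

  private
    Target : ℕ → Set
    Target j = i < j × j ≤ length w × Sat w j γ

    Occurs Avoids : ℕ → Word⁺ n → Set
    Occurs j u = OccursBetween w i j u
    Avoids j v = ¬ OccursBetween w i j v

    Pairwise : List⁺ (Word⁺ n) → List⁺ (Word⁺ n) → Set
    Pairwise us vs =
      All (λ u → All (λ v → Sat w i (F (pos u ∷ neg v ∷ []) γ)) (toList vs)) (toList us)

  lhs⇒pairwise : ∀ us vs → Sat w i (lhs us vs γ) → Pairwise us vs
  lhs⇒pairwise us vs (j , i<j , j≤∣w∣ , γj , lits)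
    with ++⁻ (map pos (toList us)) lits
  ... | occs , avoids =
    All.map (λ occ → All.map (λ avoid → j , i<j , j≤∣w∣ , γj , occ ∷ avoid ∷ [])
                             (map⁻ avoids))
            (map⁻ occs)

  pairwise⇒lhs : ∀ us vs → Pairwise us vs → Sat w i (lhs us vs γ)
  pairwise⇒lhs (u ∷ us) (v ∷ vs) pairs =
    let j , ((i<j , j≤∣w∣ , γj) , avoids) , occs =
          common-witness (λ j k → ≤-total k j) occursBetween-monoʳ u us
            (All.map (λ {u} → avoid-all u) pairs)
    in j , i<j , j≤∣w∣ , γj , ++⁺ (map⁺ occs) (map⁺ avoids)
    where
    avoid-all : ∀ u → All (λ v → Sat w i (F (pos u ∷ neg v ∷ []) γ)) (v ∷ vs) →
                ∃[ j ] (Target j × All (Avoids j) (v ∷ vs)) × Occurs j u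
    avoid-all u pairs =
      let j , (target , occ) , avoids =
            common-witness ≤-total ¬occursBetween-antitoneʳ v vs
              (All.map (λ { (j , i<j , j≤∣w∣ , γj , occ ∷ avoid ∷ []) →
                            j , ((i<j , j≤∣w∣ , γj) , occ) , avoid }) pairs)
      in j , (target , avoids) , occ

  lhs⇔rhs : ∀ us vs → Sat w i (lhs us vs γ) ⇔ Sat w i (rhs us vs γ)
  lhs⇔rhs us vs = mk⇔ (from (Sat-rhs w i us vs γ) ∘ lhs⇒pairwise us vs)
                      (pairwise⇒lhs us vs ∘ to (Sat-rhs w i us vs γ))
    where open Equivalence

nodes : Formula n → ℕ
nodes φ = length (subformulas φ)

dagSize≤nodes : (φ : Formula n) → dagSize φ ≤ nodes φ
dagSize≤nodes φ = length-deduplicate _≟F_ (subformulas φ)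

suc≤+1 : ∀ {m k} → m ≤ k → suc m ≤ k + 1
suc≤+1 {m} {k} m≤k = subst (suc m ≤_) (+-comm 1 k) (s≤s m≤k)

nodes≤size : (φ : Formula n) → nodes φ ≤ size φ
nodes≤size tt         = ≤-refl
nodes≤size (letter a) = ≤-refl
nodes≤size (not φ)    = suc≤+1 (nodes≤size φ)
nodes≤size (and φ ψ)  = suc≤+1 (begin
  length (subformulas φ ++ subformulas ψ) ≡⟨ length-++ (subformulas φ) ⟩
  nodes φ + nodes ψ                       ≤⟨ +-mono-≤ (nodes≤size φ) (nodes≤size ψ) ⟩
  size φ + size ψ                         ∎)
  where open ≤-Reasoning
nodes≤size (F R γ)    = suc≤+1 (≤-trans (nodes≤size γ) (m≤n+m (size γ) (sum (map litSize R))))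
nodes≤size (P R γ)    = suc≤+1 (≤-trans (nodes≤size γ) (m≤n+m (size γ) (sum (map litSize R))))

nodes-⋀ : (m : ℕ) (φs : List⁺ (Formula n)) →
  All (λ φ → nodes φ ≤ m) (toList φs) → nodes (⋀ φs) ≤ List⁺.length φs * suc m
nodes-⋀ m (φ ∷ φs) = go φ φs
  where
  go : ∀ φ φs → All (λ φ → nodes φ ≤ m) (φ ∷ φs) →
       nodes (⋀ (φ ∷ φs)) ≤ suc (length φs) * suc m
  go φ []       (φ≤m ∷ []) = m≤n⇒m≤n+o 0 (m≤n⇒m≤1+n φ≤m)
  go φ (ψ ∷ ψs) (φ≤m ∷ ψs≤m) = s≤s (begin
    length (subformulas φ ++ subformulas (⋀ (ψ ∷ ψs))) ≡⟨ length-++ (subformulas φ) ⟩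
    nodes φ + nodes (⋀ (ψ ∷ ψs))                       ≤⟨ +-mono-≤ φ≤m (go ψ ψs ψs≤m) ⟩
    m + suc (length ψs) * suc m                        ∎)
    where open ≤-Reasoning

length≤sum-litSize : (R : List (Lit n)) → length R ≤ sum (map litSize R)
length≤sum-litSize []                  = z≤n
length≤sum-litSize (pos (_ ∷ _) ∷ R) = +-mono-≤ (s≤s z≤n) (length≤sum-litSize R)
length≤sum-litSize (neg (_ ∷ _) ∷ R) = +-mono-≤ (s≤s z≤n) (length≤sum-litSize R)

dagSize-rhs≤size-lhs³ : (us vs : List⁺ (Word⁺ n)) (γ : Formula n) →
  dagSize (rhs us vs γ) ≤ size (lhs us vs γ) ^ 3
dagSize-rhs≤size-lhs³ {n} us vs γ = begin
  dagSize (rhs us vs γ)                   ≤⟨ dagSize≤nodes (rhs us vs γ) ⟩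
  nodes (rhs us vs γ)                     ≤⟨ nodes-⋀ (suc (size γ)) conjuncts conjunct-nodes ⟩
  List⁺.length conjuncts * (2 + size γ)   ≡⟨ cong (_* (2 + size γ)) length-conjuncts ⟩
  p * r * (2 + size γ)                    ≡⟨ *-assoc p r (2 + size γ) ⟩
  p * (r * (2 + size γ))                  ≤⟨ *-mono-≤ p≤S (*-mono-≤ r≤S 2+size≤S) ⟩
  S * (S * S)                             ≡⟨ cong (λ k → S * (S * k)) (*-identityʳ S) ⟨
  S ^ 3                                   ∎
  where
  open ≤-Reasoning
  pair : Word⁺ n → Word⁺ n → Formula n
  pair u v = F (pos u ∷ neg v ∷ []) γ

  conjuncts : List⁺ (Formula n)
  conjuncts = List⁺.concatMap (λ u → List⁺.map (pair u) vs) us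

  lits : List (Lit n)
  lits = map pos (toList us) ++ map neg (toList vs)

  p r S : ℕ
  p = List⁺.length us
  r = List⁺.length vs
  S = size (lhs us vs γ)

  conjunct-nodes : All (λ φ → nodes φ ≤ suc (size γ)) (toList conjuncts)
  conjunct-nodes = subst (All _) (sym (toList-concatMap⁺-map⁺ pair us vs))
    (Equivalence.from (All-cartesianProductWith pair (toList us) (toList vs))
      (All.universal (λ _ → All.universal (λ _ → s≤s (nodes≤size γ)) (toList vs)) (toList us)))

  length-conjuncts : List⁺.length conjuncts ≡ p * r
  length-conjuncts = trans (cong length (toList-concatMap⁺-map⁺ pair us vs))
                           (length-cartesianProductWith pair (toList us) (toList vs))

  p+r≤sum : p + r ≤ sum (map litSize lits)
  p+r≤sum = subst (_≤ sum (map litSize lits))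
    (trans (length-++ (map pos (toList us)))
           (cong₂ _+_ (length-map pos (toList us)) (length-map neg (toList vs))))
    (length≤sum-litSize lits)

  sum≤S : sum (map litSize lits) ≤ S
  sum≤S = ≤-trans (m≤m+n _ (size γ)) (m≤m+n _ 1)

  p≤S : p ≤ S
  p≤S = ≤-trans (m≤m+n p r) (≤-trans p+r≤sum sum≤S)

  r≤S : r ≤ S
  r≤S = ≤-trans (m≤n+m r p) (≤-trans p+r≤sum sum≤S)

  2+size≤S : 2 + size γ ≤ S
  2+size≤S = suc≤+1 (+-monoˡ-≤ (size γ) (≤-trans (s≤s z≤n) p+r≤sum))

lemma4p6 : ((n : ℕ) (us vs : List⁺ (Word⁺ n)) (γ : Formula n) →
      lhs us vs γ ≡ₛ rhs us vs γ)
    × Σ ℕ (λ c → Σ ℕ (λ d →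
        (n : ℕ) (us vs : List⁺ (Word⁺ n)) (γ : Formula n) →
          dagSize (rhs us vs γ) ≤ c * size (lhs us vs γ) ^ d + c))
lemma4p6 = equivalent , 1 , 3 , cubic
  where
  equivalent : (n : ℕ) (us vs : List⁺ (Word⁺ n)) (γ : Formula n) → lhs us vs γ ≡ₛ rhs us vs γ
  equivalent n us vs γ w i _ _ = to , from
    where open Equivalence (lhs⇔rhs w i γ us vs)
  cubic : (n : ℕ) (us vs : List⁺ (Word⁺ n)) (γ : Formula n) →
          dagSize (rhs us vs γ) ≤ 1 * size (lhs us vs γ) ^ 3 + 1
  cubic n us vs γ = ≤-trans (dagSize-rhs≤size-lhs³ us vs γ)
    (m≤n⇒m≤n+o 1 (≤-reflexive (sym (*-identityˡ _))))
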